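{- Let $2\le n_1<\cdots<n_m$, $t_1,\dots,t_m\ge1$, $\overline{t}_k=\sum_{i\le k}t_i$, $t=\overline{t}_m$, $N=\prod n_i^{t_i}$, $G=K_{n_1}^{t_1}\square\cdots\square K_{n_m}^{t_m}$. Let $O$ be an ordering of $V(G)$, viewed as an $N\times t$ matrix, that induces a consecutive radio labeling of $G$. Let $u$ be the $j$-th column of $O$, where $\overline{t}_{k-1}<j\le\overline{t}_k$, and let $\sigma\in S_{n_k}$. Then $O_{u,\sigma}$ also induces a consecutive radio labeling of $G$.
   Context: $K_n$ is the complete graph on $\{v_1,\dots,v_n\}$; $\square$ is the Cartesian product of graphs and $H^s$ the $s$-fold Cartesian power. Vertices of $G$ are $t$-tuples $(x_1,\dots,x_t)$ with $x_j\in V(K_{n_k})$ for $\overline{t}_{k-1}<j\le\overline{t}_k$ ($\overline{t}_0=0$); distance is the number of differing coordinates, and $\mathrm{diam}(G)=t$. An ordering $O=(v^1,\dots,v^N)$ of $V(G)$ (a list of all vertices without repetition) is viewed as the $N\times t$ matrix whose $i$-th row is $v^i$. For column $j$ of $O$ with entries in $V(K_{n_k})$ and $\sigma\in S_{n_k}$, $O_{u,\sigma}$ is the matrix obtained by replacing each entry $v_l$ in column $j$ by $v_{\sigma(l)}$. A radio labeling of a connected graph $H$ is $f:V(H)\to\mathbb{Z}^+$ with $|f(u)-f(v)|\ge\mathrm{diam}(H)+1-d(u,v)$ for distinct $u,v$; it is consecutive if bijective onto $\{1,\dots,|V(H)|\}$. The labeling induced by an ordering is $f(v^1)=1$, $f(v^i)=\min\{x\in\mathbb{Z}:x>f(v^{i-1}),\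 |x-f(v^j)|\ge\mathrm{diam}+1-d(v^i,v^j)\ \forall j<i\}$. -}

module Defs where

open import Data.Nat using (ℕ; zero; suc; _+_; _*_; _∸_; _^_; _≤_; _<_; ∣_-_∣)
open import Data.Fin using (Fin; toℕ; _≟_)
import Data.Fin as F
open import Data.List using (List; []; _∷_; length; lookup; replicate; concatMap; allFin; map)
open import Data.Nat.ListAction using (sum; product)
open import Data.Product using (Σ; ∃; _×_; _,_)
open import Relation.Binary.PropositionalEquality using (_≡_; _≢_)
open import Relation.Nullary using (yes; no)
open import Data.Fin.Permutation using (Permutation′; _⟨$⟩ʳ_)

-- A tuple whose i-th coordinate lies in Fin (lookup ss i):
-- an element of V(K_{s_1}) × ... × V(K_{s_r}) with V(K_s) = Fin s.
data Tuple : List ℕ → Set where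
  []  : Tuple []
  _∷_ : ∀ {s ss} → Fin s → Tuple ss → Tuple (s ∷ ss)

-- Hamming distance: number of differing coordinates
-- (= graph distance in a Cartesian product of complete graphs).
dist : ∀ {ss} → Tuple ss → Tuple ss → ℕ
dist [] [] = 0
dist (x ∷ xs) (y ∷ ys) with x ≟ y
... | yes _ = dist xs ys
... | no  _ = suc (dist xs ys)

mapCol : ∀ {ss} (j : Fin (length ss)) → (Fin (lookup ss j) → Fin (lookup ss j)) → Tuple ss → Tuple ss
mapCol F.zero    h (x ∷ xs) = h x ∷ xs
mapCol (F.suc j) h (x ∷ xs) = x ∷ mapCol j h xs

-- Parameters of G = K_{n_1}^{t_1} □ ... □ K_{n_m}^{t_m}.
-- Column sizes: coordinates t̄_{k-1} < j ≤ t̄_k range over V(K_{n_k}).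
sizes : (m : ℕ) → (Fin m → ℕ) → (Fin m → ℕ) → List ℕ
sizes m n ts = concatMap (λ k → replicate (ts k) (n k)) (allFin m)

Vtx : (m : ℕ) → (Fin m → ℕ) → (Fin m → ℕ) → Set
Vtx m n ts = Tuple (sizes m n ts)

-- t = t̄_m = diam(G)
tTot : (m : ℕ) → (Fin m → ℕ) → ℕ
tTot m ts = sum (map ts (allFin m))

NN : (m : ℕ) → (Fin m → ℕ) → (Fin m → ℕ) → ℕ
NN m n ts = product (map (λ k → n k ^ ts k) (allFin m))

module _ {m : ℕ} {n ts : Fin m → ℕ} where
  V = Vtx m n ts
  D = tTot m ts
  N = NN m n ts

  IsOrdering : (Fin N → V) → Set
  IsOrdering O = (∀ i i′ → O i ≡ O i′ → i ≡ i′) × (∀ v → ∃ λ i → O i ≡ v)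

  IsRadioLabeling : (V → ℕ) → Set
  IsRadioLabeling f = (∀ v → 1 ≤ f v) × (∀ u v → u ≢ v → D + 1 ∸ dist u v ≤ ∣ f u - f v ∣)

  IsConsecutiveRadioLabeling : (V → ℕ) → Set
  IsConsecutiveRadioLabeling f =
    IsRadioLabeling f × (∀ u v → f u ≡ f v → u ≡ v) × (∀ v → f v ≤ N)
      × (∀ x → 1 ≤ x → x ≤ N → ∃ λ v → f v ≡ x)

  IsLeast : (ℕ → Set) → ℕ → Set
  IsLeast P x = P x × (∀ y → P y → x ≤ y)

  -- Admissible values for the label of v^i in the induced labeling
  -- (positions are 0-based here: toℕ i = 0 is v^1).
  Admissible : (Fin N → V) → (V → ℕ) → Fin N → ℕ → Set
  Admissible O f i x =
      (toℕ i ≡ 0 → x ≡ 1)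
    × (∀ i′ → suc (toℕ i′) ≡ toℕ i → f (O i′) < x)
    × (∀ j → toℕ j < toℕ i → D + 1 ∸ dist (O i) (O j) ≤ ∣ x - f (O j) ∣)

  IsInducedBy : (Fin N → V) → (V → ℕ) → Set
  IsInducedBy O f = ∀ i → IsLeast (Admissible O f i) (f (O i))

  InducesConsecutiveRadio : (Fin N → V) → Set
  InducesConsecutiveRadio O =
    Σ (V → ℕ) λ f → IsInducedBy O f × IsConsecutiveRadioLabeling f

permCol : ∀ {m} {n ts : Fin m → ℕ} → (Fin (NN m n ts) → Vtx m n ts)
        → (j : Fin (length (sizes m n ts))) → Permutation′ (lookup (sizes m n ts) j)
        → Fin (NN m n ts) → Vtx m n ts
permCol O j σ i = mapCol j (σ ⟨$⟩ʳ_) (O i)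

-- A permutation of the symbols in one column is an automorphism of G: it is a
-- bijection on vertices preserving the Hamming distance.  Both the ordering
-- property and the induced labeling (which only sees the distances along O) are
-- transported along any such automorphism φ, the new labeling being f ∘ φ⁻¹.
module Submission where

open import Defs
open import Data.Nat using (ℕ; suc; _+_; _∸_; _≤_; _<_; ∣_-_∣)
open import Data.Fin using (Fin; _≟_)
import Data.Fin as F
open import Data.List using (List; _∷_; length; lookup)
open import Data.Product using (_×_; _,_)
open import Data.Fin.Permutation using (Permutation′; _⟨$⟩ʳ_; _⟨$⟩ˡ_; inverseˡ; inverseʳ)
open import Function using (_∘_)
open import Function.Definitions using (Injective)
open import Relation.Binary.PropositionalEquality
open import Relation.Nullary using (yes; no; contradiction)

mapCol-inverse : ∀ {ss} (j : Fin (length ss)) {h g : Fin (lookup ss j) → Fin (lookup ss j)}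
  → (∀ a → g (h a) ≡ a) → (x : Tuple ss) → mapCol j g (mapCol j h x) ≡ x
mapCol-inverse {_ ∷ _} F.zero    g∘h (x ∷ xs) = cong (_∷ xs) (g∘h x)
mapCol-inverse {_ ∷ _} (F.suc j) g∘h (x ∷ xs) = cong (x ∷_) (mapCol-inverse j g∘h xs)

dist-mapCol : ∀ {ss} (j : Fin (length ss)) {h : Fin (lookup ss j) → Fin (lookup ss j)}
  → Injective _≡_ _≡_ h → (x y : Tuple ss) → dist (mapCol j h x) (mapCol j h y) ≡ dist x y
dist-mapCol {_ ∷ _} F.zero {h} h-inj (x ∷ xs) (y ∷ ys) with x ≟ y | h x ≟ h y
... | yes _   | yes _    = refl
... | no  _   | no  _    = refl
... | yes x≡y | no hx≢hy = contradiction (cong h x≡y) hx≢hy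
... | no  x≢y | yes hx≡hy = contradiction (h-inj hx≡hy) x≢y
dist-mapCol {_ ∷ _} (F.suc j) h-inj (x ∷ xs) (y ∷ ys) with x ≟ y
... | yes _ = dist-mapCol j h-inj xs ys
... | no  _ = cong suc (dist-mapCol j h-inj xs ys)

record Isometry (ss : List ℕ) : Set where
  field
    to from  : Tuple ss → Tuple ss
    from∘to  : ∀ v → from (to v) ≡ v
    to∘from  : ∀ v → to (from v) ≡ v
    dist-to  : ∀ u v → dist (to u) (to v) ≡ dist u v

  to-injective : ∀ {u v} → to u ≡ to v → u ≡ v
  to-injective {u} {v} eq = trans (sym (from∘to u)) (trans (cong from eq) (from∘to v))

  from-injective : ∀ {u v} → from u ≡ from v → u ≡ v
  from-injective {u} {v} eq = trans (sym (to∘from u)) (trans (cong to eq) (to∘from v))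

  dist-from : ∀ u v → dist (from u) (from v) ≡ dist u v
  dist-from u v = trans (sym (dist-to (from u) (from v))) (cong₂ dist (to∘from u) (to∘from v))

permuteColumn : ∀ {ss} (j : Fin (length ss)) → Permutation′ (lookup ss j) → Isometry ss
permuteColumn j σ = record
  { to      = mapCol j (σ ⟨$⟩ʳ_)
  ; from    = mapCol j (σ ⟨$⟩ˡ_)
  ; from∘to = mapCol-inverse j (λ _ → inverseˡ σ)
  ; to∘from = mapCol-inverse j (λ _ → inverseʳ σ)
  ; dist-to = dist-mapCol j σ-injective
  }
  where
  σ-injective : Injective _≡_ _≡_ (σ ⟨$⟩ʳ_)
  σ-injective σa≡σb = trans (sym (inverseˡ σ)) (trans (cong (σ ⟨$⟩ˡ_) σa≡σb) (inverseˡ σ))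

module _ {m : ℕ} {n ts : Fin m → ℕ} where

  Admissible-cong : ∀ {O O′ f f′}
    → (∀ i → f (O i) ≡ f′ (O′ i))
    → (∀ i k → dist (O i) (O k) ≡ dist (O′ i) (O′ k))
    → ∀ i x → Admissible {m} {n} {ts} O f i x → Admissible {m} {n} {ts} O′ f′ i x
  Admissible-cong fO≡ d≡ i x (first , increasing , separated) =
      first
    , (λ i′ i′+1≡i → subst (_< x) (fO≡ i′) (increasing i′ i′+1≡i))
    , (λ k k<i → subst₂ (λ d y → tTot m ts + 1 ∸ d ≤ ∣ x - y ∣)
                        (d≡ i k) (fO≡ k) (separated k k<i))

  IsInducedBy-cong : ∀ {O O′ f f′}
    → (∀ i → f (O i) ≡ f′ (O′ i))
    → (∀ i k → dist (O i) (O k) ≡ dist (O′ i) (O′ k))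
    → IsInducedBy {m} {n} {ts} O f → IsInducedBy {m} {n} {ts} O′ f′
  IsInducedBy-cong {O} {O′} {f} {f′} fO≡ d≡ induced i with induced i
  ... | admissible , least =
      subst (Admissible {m} {n} {ts} O′ f′ i) (fO≡ i)
        (Admissible-cong {O} {O′} {f} {f′} fO≡ d≡ i (f (O i)) admissible)
    , λ y admissible′ → subst (_≤ y) (fO≡ i)
        (least y (Admissible-cong {O′} {O} {f′} {f} (sym ∘ fO≡) (λ i k → sym (d≡ i k)) i y admissible′))

  module _ (φ : Isometry (sizes m n ts)) where
    open Isometry φ

    IsOrdering-isometry : ∀ {O} → IsOrdering {m} {n} {ts} O → IsOrdering {m} {n} {ts} (to ∘ O)
    IsOrdering-isometry (O-injective , O-surjective) =
        (λ i i′ eq → O-injective i i′ (to-injective eq))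
      , λ v → let (i , Oi≡) = O-surjective (from v) in i , trans (cong to Oi≡) (to∘from v)

    IsInducedBy-isometry : ∀ {O f} → IsInducedBy {m} {n} {ts} O f
      → IsInducedBy {m} {n} {ts} (to ∘ O) (f ∘ from)
    IsInducedBy-isometry {O} {f} =
      IsInducedBy-cong {O} {to ∘ O} {f} {f ∘ from}
        (λ i → cong f (sym (from∘to (O i)))) (λ i k → sym (dist-to (O i) (O k)))

    IsRadioLabeling-isometry : ∀ {f} → IsRadioLabeling {m} {n} {ts} f
      → IsRadioLabeling {m} {n} {ts} (f ∘ from)
    IsRadioLabeling-isometry (positive , radio) =
        positive ∘ from
      , λ u v u≢v → subst (λ d → tTot m ts + 1 ∸ d ≤ _) (dist-from u v)
          (radio (from u) (from v) (u≢v ∘ from-injective))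

    IsConsecutiveRadioLabeling-isometry : ∀ {f} → IsConsecutiveRadioLabeling {m} {n} {ts} f
      → IsConsecutiveRadioLabeling {m} {n} {ts} (f ∘ from)
    IsConsecutiveRadioLabeling-isometry {f} (radio , f-injective , bounded , onto) =
        IsRadioLabeling-isometry radio
      , (λ u v eq → from-injective (f-injective _ _ eq))
      , bounded ∘ from
      , λ x 1≤x x≤N → let (v , fv≡x) = onto x 1≤x x≤N in to v , trans (cong f (from∘to v)) fv≡x

    InducesConsecutiveRadio-isometry : ∀ {O} → InducesConsecutiveRadio {m} {n} {ts} O
      → InducesConsecutiveRadio {m} {n} {ts} (to ∘ O)
    InducesConsecutiveRadio-isometry {O} (f , induced , consecutive) =
        f ∘ from
      , IsInducedBy-isometry {O} {f} induced
      , IsConsecutiveRadioLabeling-isometry {f} consecutive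

lemma11 : (m : ℕ) (n ts : Fin m → ℕ)
    → (∀ k → 2 ≤ n k)
    → (∀ k l → k F.< l → n k < n l)
    → (∀ k → 1 ≤ ts k)
    → (O : Fin (NN m n ts) → Vtx m n ts)
    → IsOrdering {m} {n} {ts} O
    → InducesConsecutiveRadio {m} {n} {ts} O
    → (j : Fin (length (sizes m n ts)))
    → (σ : Permutation′ (lookup (sizes m n ts) j))
    → IsOrdering {m} {n} {ts} (permCol {m} {n} {ts} O j σ)
    × InducesConsecutiveRadio {m} {n} {ts} (permCol {m} {n} {ts} O j σ)
lemma11 m n ts _ _ _ O ordering induces j σ =
    IsOrdering-isometry {m} {n} {ts} φ ordering
  , InducesConsecutiveRadio-isometry {m} {n} {ts} φ induces
  where
  φ : Isometry (sizes m n ts)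
  φ = permuteColumn j σ
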